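{- Let $\mathcal M$ be an $(n,d)$-matching field on $L\sqcup R$ and let $\mu_1^{(1)},\mu_1^{(2)},\mu_2^{(1)},\mu_2^{(2)}$ be matchings of $\mathcal M$. Suppose the induced subgraph of the flip graph on these four matchings is the quadrangle (4-cycle) with edges $\mu_1^{(1)}\mu_1^{(2)}$, $\mu_2^{(1)}\mu_2^{(2)}$, $\mu_1^{(1)}\mu_2^{(1)}$, $\mu_1^{(2)}\mu_2^{(2)}$. Then there exist two distinct nodes $r_p,r_q\in R$ such that, for $m=1,2$: (a) $\mu_m^{(1)}$ and $\mu_m^{(2)}$ agree everywhere other than on $r_p$ (they have the same edges except the edge incident with $r_p$); (b) $\mu_1^{(m)}$ and $\mu_2^{(m)}$ agree everywhere other than on $r_q$.
   Context: $L=\{\ell_1,\dots,\ell_n\}$, $R=\{r_1,\dots,r_d\}$ with $n\ge d$; graphs are identified with edge sets. An $(n,d)$-matching field assigns to each $d$-subset $\sigma\subseteq L$ a perfect matching on $\sigma\sqcup R$. The flip graph has the matchings of the matching field as vertices, with two matchings adjacent iff they differ in exactly one edge. -}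

module Defs where

open import Data.Nat using (ℕ)
open import Data.Fin using (Fin)
open import Data.Fin.Subset using (Subset; _∈_; ∣_∣)
open import Data.Product using (Σ; ∃; _×_)
open import Relation.Binary.PropositionalEquality using (_≡_; _≢_)
open import Function.Definitions using (Injective)

-- L = Fin n (the nodes ℓ_1..ℓ_n), R = Fin d (the nodes r_1..r_d).
-- A d-subset σ ⊆ L, i.e. a subset together with a proof that it has d elements.
DSubset : ℕ → ℕ → Set
DSubset n d = Σ (Subset n) (λ σ → ∣ σ ∣ ≡ d)

-- A perfect matching on σ ⊔ R is encoded by the map R → L sending r to
-- its partner; its edge set is { (f r , r) | r ∈ R }.  It is a perfect
-- matching of σ ⊔ R iff f is injective with all values in σ (|σ| = |R| = d).
record MatchingField (n d : ℕ) : Set where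
  field
    match     : DSubset n d → Fin d → Fin n
    injective : ∀ σ → Injective _≡_ _≡_ (match σ)
    inσ       : ∀ σ r → match σ r ∈ Σ.proj₁ σ

open MatchingField public

Distinct : ∀ {n d} → (Fin d → Fin n) → (Fin d → Fin n) → Set
Distinct f g = ∃ λ r → f r ≢ g r

-- Two matchings differ in exactly one edge: the edge sets differ exactly in
-- the edge at one node r ∈ R (the edge (f r , r) vs (g r , r)).
Adjacent : ∀ {n d} → (Fin d → Fin n) → (Fin d → Fin n) → Set
Adjacent f g = ∃ λ r → f r ≢ g r × (∀ r' → r' ≢ r → f r' ≡ g r')

AgreeExcept : ∀ {n d} → Fin d → (Fin d → Fin n) → (Fin d → Fin n) → Set
AgreeExcept p f g = ∀ r → r ≢ p → f r ≡ g r

module Submission where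

-- Write f ~[x] g when the matchings f, g (partner maps R → L) agree except
-- at the node x ∈ R.  The four flip edges of the quadrangle give nodes with
--   μ₁₁ ~[p] μ₁₂,  μ₂₁ ~[p'] μ₂₂,  μ₁₁ ~[q] μ₂₁,  μ₁₂ ~[q'] μ₂₂,
-- and it remains to show p ≢ q, p ≡ p' and q' ≡ q.
--   * ~[x] is symmetric and transitive, and f ~[a] g ~[b] h confines the
--     nodes where f and h differ to {a, b}.
--   * Two matchings differing at some node and agreeing except at x are
--     adjacent; so p ≡ q would make the diagonal μ₁₂ μ₂₁ a flip edge.
--   * Distinct non-adjacent matchings differ at two distinct nodes (found by
--     a finite search over R).  For the diagonal μ₁₁ μ₂₂ both nodes lie in
--     {p, q'} ∩ {q, p'}; as p ≢ q, an elementary lemma on such intersections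
--     forces p ≡ p' and q' ≡ q.

open import Defs
open import Data.Nat using (ℕ; _≤_)
open import Data.Fin using (Fin; _≟_)
open import Data.Fin.Properties using (¬∀⟶∃¬)
open import Data.Product using (∃₂; _×_; _,_; proj₁; proj₂)
open import Data.Sum using (_⊎_; inj₁; inj₂)
open import Data.Empty using (⊥-elim)
open import Relation.Nullary using (¬_; yes; no)
open import Relation.Nullary.Decidable using (decidable-stable; _⊎-dec_)
open import Relation.Binary.PropositionalEquality using (_≡_; _≢_; refl; sym; trans; subst)

private
  variable
    n d : ℕ
    f g h : Fin d → Fin n
    a b x : Fin d

agreeExcept-sym : AgreeExcept x f g → AgreeExcept x g f
agreeExcept-sym f~g r r≢x = sym (f~g r r≢x)

agreeExcept-trans : AgreeExcept x f g → AgreeExcept x g h → AgreeExcept x f h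
agreeExcept-trans f~g g~h r r≢x = trans (f~g r r≢x) (g~h r r≢x)

differences-within : AgreeExcept a f g → AgreeExcept b g h
  → ∀ r → f r ≢ h r → r ≡ a ⊎ r ≡ b
differences-within {a = a} {b = b} f~g g~h r fr≢hr with r ≟ a | r ≟ b
... | yes r≡a | _        = inj₁ r≡a
... | no _    | yes r≡b  = inj₂ r≡b
... | no r≢a  | no r≢b   = ⊥-elim (fr≢hr (trans (f~g r r≢a) (g~h r r≢b)))

adjacent-from-agreeExcept : ∀ {r} → f r ≢ g r → AgreeExcept x f g → Adjacent f g
adjacent-from-agreeExcept {x = x} {r = r} fr≢gr f~g
  with decidable-stable (r ≟ x) (λ r≢x → fr≢gr (f~g r r≢x))
... | refl = r , fr≢gr , f~g

-- Distinct matchings that are not adjacent differ at two distinct nodes: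
-- searching R for a node other than the known difference r₀ where they
-- also differ must succeed, for otherwise they would be adjacent at r₀.
two-differences : ∀ {n d} {f g : Fin d → Fin n} → Distinct f g → ¬ Adjacent f g
  → ∃₂ λ x y → x ≢ y × f x ≢ g x × f y ≢ g y
two-differences {d = d} {f = f} {g = g} (r₀ , fr₀≢gr₀) ¬adj
  with ¬∀⟶∃¬ d (λ r → r ≡ r₀ ⊎ f r ≡ g r) (λ r → (r ≟ r₀) ⊎-dec (f r ≟ g r)) ¬agree
  where
  ¬agree : ¬ (∀ r → r ≡ r₀ ⊎ f r ≡ g r)
  ¬agree agree = ¬adj (r₀ , fr₀≢gr₀ , only-at-r₀)
    where
    only-at-r₀ : AgreeExcept r₀ f g
    only-at-r₀ r r≢r₀ with agree r
    ... | inj₁ r≡r₀ = ⊥-elim (r≢r₀ r≡r₀)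
    ... | inj₂ fr≡gr = fr≡gr
... | r , ¬[r≡r₀⊎fr≡gr] =
  r , r₀ , (λ r≡r₀ → ¬[r≡r₀⊎fr≡gr] (inj₁ r≡r₀))
         , (λ fr≡gr → ¬[r≡r₀⊎fr≡gr] (inj₂ fr≡gr)) , fr₀≢gr₀

crosswise : ∀ {A : Set} {a b c e u v : A} → a ≢ c → u ≢ v
  → (u ≡ a ⊎ u ≡ b) → (u ≡ c ⊎ u ≡ e) → (v ≡ a ⊎ v ≡ b) → (v ≡ c ⊎ v ≡ e)
  → a ≡ e × b ≡ c
crosswise a≢c u≢v (inj₁ refl) (inj₁ refl) _ _ = ⊥-elim (a≢c refl)
crosswise a≢c u≢v (inj₂ refl) (inj₁ refl) (inj₁ refl) (inj₁ refl) = ⊥-elim (a≢c refl)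
crosswise a≢c u≢v _ _ (inj₁ refl) (inj₁ refl) = ⊥-elim (a≢c refl)
crosswise a≢c u≢v (inj₁ refl) (inj₂ refl) (inj₁ refl) _ = ⊥-elim (u≢v refl)
crosswise a≢c u≢v (inj₂ refl) _ (inj₂ refl) _ = ⊥-elim (u≢v refl)
crosswise a≢c u≢v _ (inj₂ refl) _ (inj₂ refl) = ⊥-elim (u≢v refl)
crosswise a≢c u≢v (inj₁ refl) (inj₂ refl) (inj₂ refl) (inj₁ refl) = refl , refl
crosswise a≢c u≢v (inj₂ refl) (inj₁ refl) (inj₁ refl) (inj₂ refl) = refl , refl

lemma3p40 : (n d : ℕ) → d ≤ n → (M : MatchingField n d)
    → (s11 s12 s21 s22 : DSubset n d)
    → Distinct (match M s11) (match M s12) → Distinct (match M s11) (match M s21) → Distinct (match M s11) (match M s22)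
    → Distinct (match M s12) (match M s21) → Distinct (match M s12) (match M s22) → Distinct (match M s21) (match M s22)
    → Adjacent (match M s11) (match M s12) → Adjacent (match M s21) (match M s22) → Adjacent (match M s11) (match M s21) → Adjacent (match M s12) (match M s22)
    → ¬ Adjacent (match M s11) (match M s22) → ¬ Adjacent (match M s12) (match M s21)
    → ∃₂ λ (p q : Fin d) → p ≢ q
    × (AgreeExcept p (match M s11) (match M s12) × AgreeExcept p (match M s21) (match M s22))
    × (AgreeExcept q (match M s11) (match M s21) × AgreeExcept q (match M s12) (match M s22))
lemma3p40 n d _ M s11 s12 s21 s22 _ _ dist11,22 (r , μ₁₂r≢μ₂₁r) _ _
  (p , _ , μ₁₁~μ₁₂) (p' , _ , μ₂₁~μ₂₂) (q , _ , μ₁₁~μ₂₁) (q' , _ , μ₁₂~μ₂₂) ¬adj11,22 ¬adj12,21 =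
  p , q , p≢q
    , (μ₁₁~μ₁₂ , subst (λ x → AgreeExcept x _ _) (sym p≡p') μ₂₁~μ₂₂)
    , (μ₁₁~μ₂₁ , subst (λ x → AgreeExcept x _ _) q'≡q μ₁₂~μ₂₂)
  where
  -- If p ≡ q then μ₁₂ ~[p] μ₁₁ ~[p] μ₂₁ would make μ₁₂ μ₂₁ a flip edge.
  p≢q : p ≢ q
  p≢q refl = ¬adj12,21 (adjacent-from-agreeExcept μ₁₂r≢μ₂₁r
                         (agreeExcept-trans (agreeExcept-sym μ₁₁~μ₁₂) μ₁₁~μ₂₁))
  via-μ₁₂ : ∀ u → match M s11 u ≢ match M s22 u → u ≡ p ⊎ u ≡ q'
  via-μ₁₂ = differences-within μ₁₁~μ₁₂ μ₁₂~μ₂₂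
  via-μ₂₁ : ∀ u → match M s11 u ≢ match M s22 u → u ≡ q ⊎ u ≡ p'
  via-μ₂₁ = differences-within μ₁₁~μ₂₁ μ₂₁~μ₂₂
  -- The diagonal μ₁₁ μ₂₂ differs at two distinct nodes, both in {p, q'} ∩ {q, p'}.
  opposite-sides : p ≡ p' × q' ≡ q
  opposite-sides with two-differences dist11,22 ¬adj11,22
  ... | u , v , u≢v , μu , μv =
    crosswise p≢q u≢v (via-μ₁₂ u μu) (via-μ₂₁ u μu) (via-μ₁₂ v μv) (via-μ₂₁ v μv)
  p≡p' : p ≡ p'
  p≡p' = proj₁ opposite-sides
  q'≡q : q' ≡ q
  q'≡q = proj₂ opposite-sides
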